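{- Let $\lambda$ be a nonzero real number. Define the degenerate B-algorithm matrix $(a_{n,m}(\lambda))_{n,m\ge0}$ by $a_{0,0}(\lambda)=0$, $a_{0,m}(\lambda)=\frac{(-1)^m}{m!}$ for $m\ge1$, and \[ a_{n,m}(\lambda)=\big(m-(n-1)\lambda\big)a_{n-1,m}(\lambda)-(m+1)a_{n-1,m+1}(\lambda),\qquad n\ge1,\ m\ge0. \] Then for every $n\ge1$, \[ a_{n,0}(\lambda)=\sum_{k=1}^{n}{n \brace k}_{\lambda}=\phi_{n,\lambda}. \]
   Context: For $n\ge0$ set $(x)_{0,\lambda}=1$, $(x)_{n,\lambda}=x(x-\lambda)\cdots(x-(n-1)\lambda)$ for $n\ge1$, and $(x)_0=1$, $(x)_n=x(x-1)\cdots(x-n+1)$ for $n\ge1$. The degenerate Stirling numbers of the second kind ${n \brace k}_{\lambda}$ are defined by $(x)_{n,\lambda}=\sum_{k=0}^{n}{n \brace k}_{\lambda}(x)_{k}$. The degenerate Bell numbers are $\phi_{n,\lambda}=\sum_{k=0}^{n}{n \brace k}_{\lambda}$; equivalently $e^{e_\lambda(t)-1}=\sum_{n\ge0}\phi_{n,\lambda}\frac{t^n}{n!}$, where $e_\lambda(t)=(1+\lambda t)^{1/\lambda}=\sum_{k\ge0}(1)_{k,\lambda}\frac{t^k}{k!}$. -}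

module Defs where

open import Level using (Level)
open import Data.Nat using (ℕ; zero; suc)
open import Data.Nat.Combinatorics using ()
open import Algebra.Bundles using (CommutativeRing)

-- All definitions are over an arbitrary commutative ring R
-- (the paper works over the reals, an instance).
module Ops {c ℓ : Level} (R : CommutativeRing c ℓ) where
  open CommutativeRing R

  ι : ℕ → Carrier
  ι zero    = 0#
  ι (suc n) = 1# + ι n

  sgn : ℕ → Carrier
  sgn zero    = 1#
  sgn (suc m) = - (sgn m)

  sumTo : ℕ → (ℕ → Carrier) → Carrier
  sumTo zero    f = f 0
  sumTo (suc n) f = sumTo n f + f (suc n)

  sum1To : ℕ → (ℕ → Carrier) → Carrier
  sum1To zero    f = 0#
  sum1To (suc n) f = sum1To n f + f (suc n)

  dfall : Carrier → Carrier → ℕ → Carrier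
  dfall lam x zero    = 1#
  dfall lam x (suc n) = dfall lam x n * (x - ι n * lam)

  fall : Carrier → ℕ → Carrier
  fall x zero    = 1#
  fall x (suc n) = fall x n * (x - ι n)

  -- The degenerate B-algorithm matrix a_{n,m}(lam).
  -- inv m is (a given) inverse of m! in R, so a_{0,m} = (-1)^m / m!.
  amat : Carrier → (ℕ → Carrier) → ℕ → ℕ → Carrier
  amat lam inv zero    zero    = 0#
  amat lam inv zero    (suc m) = sgn (suc m) * inv (suc m)
  amat lam inv (suc n) m =
    (ι m - ι n * lam) * amat lam inv n m - ι (suc m) * amat lam inv n (suc m)

  IsDegStirling2 : Carrier → (ℕ → ℕ → Carrier) → Set (c Level.⊔ ℓ)
  IsDegStirling2 lam S = ∀ (n : ℕ) (x : Carrier) →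
    dfall lam x n ≈ sumTo n (λ k → S n k * fall x k)

  degBell : (ℕ → ℕ → Carrier) → ℕ → Carrier
  degBell S n = sumTo n (S n)

{-# OPTIONS --safe #-}
module Submission where

-- Let ψ j be the coefficient sequence of (1 - t)^j e^(-t), so ψ j 0 = 1 and ψ 0 is row 0 of the
-- matrix except at m = 0. The B-algorithm step u ↦ ((m - c) u m - (m + 1) u (m + 1))ₘ sends ψ j
-- to ψ (j + 1) + (j - c) ψ j, just as multiplication by x - c sends (x)_j to
-- (x)_(j+1) + (j - c) (x)_j. Hence for n ≥ 1 row n is Σ_k S(n,k) ψ k, where S(n,k) are the
-- coefficients of (x)_(n,λ) = Π_(i<n) (x - iλ) in the falling factorial basis, and column 0 is
-- Σ_k S(n,k) = φ_(n,λ). These coefficients are unique, hence the given ones, because (k)_j = 0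
-- for j > k while (k)_k = k! is invertible; finally S(n,0) = 0 for n ≥ 1.

open import Defs
open import Data.Nat using (ℕ; _≤_; _!)
open import Data.Product using (_×_)
open import Relation.Nullary using (¬_)
open import Algebra.Bundles using (CommutativeRing)

open import Level using (Level)
open import Data.Nat as ℕ using (zero; suc; _<_; z≤n; s≤s)
open import Data.Nat.Properties as ℕ using (m≤n⇒m≤1+n; m≤n⇒m<n∨m≡n; ≤-refl; <⇒≢; >⇒≢)
open import Data.Nat.Induction using (<-rec)
open import Data.Integer as ℤ using (ℤ; +_; -[1+_]; _⊖_; sign; ∣_∣; _◃_)
import Data.Integer.Properties as ℤ
open import Data.Sign as Sign using (Sign)
open import Data.Maybe using (Maybe; just; nothing)
open import Data.Product using (_,_)
open import Data.Sum using (inj₁; inj₂)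
open import Relation.Binary.Definitions using (tri<; tri≈; tri>)
open import Relation.Nullary using (yes; no; contradiction)
open import Relation.Binary.PropositionalEquality as ≡ using (_≢_)
open import Algebra.Solver.Ring.AlmostCommutativeRing
  using (fromCommutativeRing; _-Raw-AlmostCommutative⟶_)
import Algebra.Solver.Ring as RingSolver
import Algebra.Properties.Ring as RingProperties
import Algebra.Properties.CommutativeSemigroup as CommutativeSemigroupProperties
import Algebra.Properties.Semiring.Mult.TCOptimised as SemiringMult
import Relation.Binary.Reasoning.Setoid as SetoidReasoning

module _ {r ℓ : Level} (R : CommutativeRing r ℓ) where
  open CommutativeRing R hiding (zero)
  open Ops R
  open RingProperties ring
    using (-0#≈0#; -‿+-comm; -‿involutive; -1*x≈-x; [y-z]x≈yx-zx; x∙y⁻¹≈ε⇒x≈y)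
  open CommutativeSemigroupProperties +-commutativeSemigroup
    using () renaming (interchange to +-interchange; x∙yz≈y∙xz to +-leftComm)
  open CommutativeSemigroupProperties *-commutativeSemigroup
    using () renaming (interchange to *-interchange)
  open SemiringMult semiring using (1+×; ×-homo-+; ×1-homo-*) renaming (_×_ to _×′_)
  open SetoidReasoning setoid

  ι≈× : ∀ n → ι n ≈ n ×′ 1#
  ι≈× zero    = refl
  ι≈× (suc n) = trans (+-congˡ (ι≈× n)) (sym (1+× n 1#))

  ι-* : ∀ m n → ι (m ℕ.* n) ≈ ι m * ι n
  ι-* m n = trans (ι≈× (m ℕ.* n)) (trans (×1-homo-* m n) (sym (*-cong (ι≈× m) (ι≈× n))))

  -- The ring solver needs decidable integer coefficients to cancel constants such as 1# - 1#.
  module IntegerCoefficients where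

    fromℤ : ℤ → Carrier
    fromℤ (+ n)    = n ×′ 1#
    fromℤ -[1+ n ] = - (suc n ×′ 1#)

    [1+a]-[1+b]≈a-b : ∀ a b → (1# + a) - (1# + b) ≈ a - b
    [1+a]-[1+b]≈a-b a b = begin
      (1# + a) + - (1# + b)    ≈⟨ +-cong (+-comm 1# a) (sym (-‿+-comm 1# b)) ⟩
      (a + 1#) + (- 1# + - b)  ≈⟨ +-assoc a 1# _ ⟩
      a + (1# + (- 1# + - b))  ≈⟨ +-congˡ (+-assoc 1# (- 1#) (- b)) ⟨
      a + ((1# - 1#) + - b)    ≈⟨ +-congˡ (+-congʳ (-‿inverseʳ 1#)) ⟩
      a + (0# + - b)           ≈⟨ +-congˡ (+-identityˡ (- b)) ⟩
      a - b                    ∎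

    ⊖-homo : ∀ m n → fromℤ (m ⊖ n) ≈ m ×′ 1# - n ×′ 1#
    ⊖-homo zero    zero    = sym (-‿inverseʳ 0#)
    ⊖-homo (suc m) zero    = sym (trans (+-congˡ -0#≈0#) (+-identityʳ _))
    ⊖-homo zero    (suc n) = sym (+-identityˡ _)
    ⊖-homo (suc m) (suc n) rewrite ℤ.[1+m]⊖[1+n]≡m⊖n m n = begin
      fromℤ (m ⊖ n)                        ≈⟨ ⊖-homo m n ⟩
      m ×′ 1# - n ×′ 1#                    ≈⟨ [1+a]-[1+b]≈a-b _ _ ⟨
      (1# + m ×′ 1#) - (1# + n ×′ 1#)      ≈⟨ +-cong (1+× m 1#) (-‿cong (1+× n 1#)) ⟨
      suc m ×′ 1# - suc n ×′ 1#            ∎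

    +-homo : ∀ i j → fromℤ (i ℤ.+ j) ≈ fromℤ i + fromℤ j
    +-homo (+ m)    (+ n)    = ×-homo-+ 1# m n
    +-homo (+ m)    -[1+ n ] = ⊖-homo m (suc n)
    +-homo -[1+ m ] (+ n)    = trans (⊖-homo n (suc m)) (+-comm _ _)
    +-homo -[1+ m ] -[1+ n ] = begin
      - (suc (suc (m ℕ.+ n)) ×′ 1#)      ≡⟨ ≡.cong (λ k → - (k ×′ 1#)) (ℕ.+-suc (suc m) n) ⟨
      - ((suc m ℕ.+ suc n) ×′ 1#)        ≈⟨ -‿cong (×-homo-+ 1# (suc m) (suc n)) ⟩
      - (suc m ×′ 1# + suc n ×′ 1#)      ≈⟨ -‿+-comm _ _ ⟨
      - (suc m ×′ 1#) + - (suc n ×′ 1#)  ∎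

    σ : Sign → Carrier
    σ Sign.+ = 1#
    σ Sign.- = - 1#

    σ-homo : ∀ s t → σ (s Sign.* t) ≈ σ s * σ t
    σ-homo Sign.+ t      = sym (*-identityˡ _)
    σ-homo Sign.- Sign.+ = sym (*-identityʳ _)
    σ-homo Sign.- Sign.- = sym (trans (-1*x≈-x _) (-‿involutive _))

    ◃-homo : ∀ s n → fromℤ (s ◃ n) ≈ σ s * n ×′ 1#
    ◃-homo s      zero    = sym (zeroʳ _)
    ◃-homo Sign.+ (suc n) = sym (*-identityˡ _)
    ◃-homo Sign.- (suc n) = sym (-1*x≈-x _)

    *-homo : ∀ i j → fromℤ (i ℤ.* j) ≈ fromℤ i * fromℤ j
    *-homo i j = begin
      fromℤ (i ℤ.* j)
        ≈⟨ ◃-homo (sign i Sign.* sign j) (∣ i ∣ ℕ.* ∣ j ∣) ⟩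
      σ (sign i Sign.* sign j) * (∣ i ∣ ℕ.* ∣ j ∣) ×′ 1#
        ≈⟨ *-cong (σ-homo (sign i) (sign j)) (×1-homo-* ∣ i ∣ ∣ j ∣) ⟩
      (σ (sign i) * σ (sign j)) * (∣ i ∣ ×′ 1# * ∣ j ∣ ×′ 1#)
        ≈⟨ *-interchange _ _ _ _ ⟩
      (σ (sign i) * ∣ i ∣ ×′ 1#) * (σ (sign j) * ∣ j ∣ ×′ 1#)
        ≈⟨ *-cong (◃-homo (sign i) ∣ i ∣) (◃-homo (sign j) ∣ j ∣) ⟨
      fromℤ (sign i ◃ ∣ i ∣) * fromℤ (sign j ◃ ∣ j ∣)
        ≡⟨ ≡.cong₂ (λ i′ j′ → fromℤ i′ * fromℤ j′) (ℤ.◃-inverse i) (ℤ.◃-inverse j) ⟩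
      fromℤ i * fromℤ j
        ∎

    -‿homo : ∀ i → fromℤ (ℤ.- i) ≈ - fromℤ i
    -‿homo (+ zero)  = sym -0#≈0#
    -‿homo (+ suc n) = refl
    -‿homo -[1+ n ]  = sym (-‿involutive _)

    homomorphism : ℤ.+-*-rawRing -Raw-AlmostCommutative⟶ fromCommutativeRing R
    homomorphism = record
      { ⟦_⟧    = fromℤ
      ; +-homo = +-homo
      ; *-homo = *-homo
      ; -‿homo = -‿homo
      ; 0-homo = refl
      ; 1-homo = refl
      }

    fromℤ-≟ : ∀ i j → Maybe (fromℤ i ≈ fromℤ j)
    fromℤ-≟ i j with i ℤ.≟ j
    ... | yes ≡.refl = just refl
    ... | no _       = nothing

  open RingSolver ℤ.+-*-rawRing (fromCommutativeRing R)
    IntegerCoefficients.homomorphism IntegerCoefficients.fromℤ-≟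
    using (solve; _:=_; _:+_; _:*_; _:-_; :-_; con; Polynomial)

  :0 :1 : ∀ {k} → Polynomial k
  :0 = con (+ 0)
  :1 = con (+ 1)

  sumTo-cong : ∀ n {f g : ℕ → Carrier} → (∀ j → j ≤ n → f j ≈ g j) → sumTo n f ≈ sumTo n g
  sumTo-cong zero    f≈g = f≈g 0 z≤n
  sumTo-cong (suc n) f≈g =
    +-cong (sumTo-cong n (λ j j≤n → f≈g j (m≤n⇒m≤1+n j≤n))) (f≈g (suc n) ≤-refl)

  sumTo-distrib-+ : ∀ n f g → sumTo n (λ j → f j + g j) ≈ sumTo n f + sumTo n g
  sumTo-distrib-+ zero    f g = refl
  sumTo-distrib-+ (suc n) f g = trans (+-congʳ (sumTo-distrib-+ n f g)) (+-interchange _ _ _ _)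

  sumTo-distrib-sub : ∀ n f g → sumTo n (λ j → f j - g j) ≈ sumTo n f - sumTo n g
  sumTo-distrib-sub zero    f g = refl
  sumTo-distrib-sub (suc n) f g = trans (+-congʳ (sumTo-distrib-sub n f g)) (sub-interchange _ _ _ _)
    where
    sub-interchange : ∀ a b x y → (a - b) + (x - y) ≈ (a + x) - (b + y)
    sub-interchange = solve 4 (λ a b x y → (a :- b) :+ (x :- y) := (a :+ x) :- (b :+ y)) refl

  *-distribˡ-sumTo : ∀ n a f → a * sumTo n f ≈ sumTo n (λ j → a * f j)
  *-distribˡ-sumTo zero    a f = refl
  *-distribˡ-sumTo (suc n) a f = trans (distribˡ a _ _) (+-congʳ (*-distribˡ-sumTo n a f))

  *-distribʳ-sumTo : ∀ n f a → sumTo n f * a ≈ sumTo n (λ j → f j * a)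
  *-distribʳ-sumTo zero    f a = refl
  *-distribʳ-sumTo (suc n) f a = trans (distribʳ a _ _) (+-congʳ (*-distribʳ-sumTo n f a))

  sumTo-shift : ∀ n f → sumTo (suc n) f ≈ f 0 + sumTo n (λ j → f (suc j))
  sumTo-shift zero    f = refl
  sumTo-shift (suc n) f = trans (+-congʳ (sumTo-shift n f)) (+-assoc _ _ _)

  sumTo≈head+sum1To : ∀ n f → sumTo n f ≈ f 0 + sum1To n f
  sumTo≈head+sum1To zero    f = sym (+-identityʳ _)
  sumTo≈head+sum1To (suc n) f = trans (+-congʳ (sumTo≈head+sum1To n f)) (+-assoc _ _ _)

  sumTo-zero : ∀ n f → (∀ j → j ≤ n → f j ≈ 0#) → sumTo n f ≈ 0#
  sumTo-zero zero    f f≈0 = f≈0 0 z≤n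
  sumTo-zero (suc n) f f≈0 =
    trans (+-cong (sumTo-zero n f (λ j j≤n → f≈0 j (m≤n⇒m≤1+n j≤n))) (f≈0 (suc n) ≤-refl))
          (+-identityʳ 0#)

  sumTo-single : ∀ n k f → k ≤ n → (∀ j → j ≤ n → j ≢ k → f j ≈ 0#) → sumTo n f ≈ f k
  sumTo-single zero    zero f z≤n   _   = refl
  sumTo-single (suc n) k    f k≤1+n off with m≤n⇒m<n∨m≡n k≤1+n
  ... | inj₁ (s≤s k≤n) =
    trans (+-cong (sumTo-single n k f k≤n (λ j j≤n → off j (m≤n⇒m≤1+n j≤n)))
                  (off (suc n) ≤-refl (>⇒≢ (s≤s k≤n))))
          (+-identityʳ _)
  ... | inj₂ ≡.refl =
    trans (+-congʳ (sumTo-zero n f (λ j j≤n → off j (m≤n⇒m≤1+n j≤n) (<⇒≢ (s≤s j≤n)))))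
          (+-identityˡ _)

  fall-cong : ∀ {x y} j → x ≈ y → fall x j ≈ fall y j
  fall-cong zero    x≈y = refl
  fall-cong (suc j) x≈y = *-cong (fall-cong j x≈y) (+-congʳ x≈y)

  fall-step : ∀ x c j → fall x j * (x - c) ≈ fall x (suc j) + (ι j - c) * fall x j
  fall-step x c j = split (fall x j) x (ι j) c
    where
    split : ∀ f x t c → f * (x - c) ≈ f * (x - t) + (t - c) * f
    split = solve 4 (λ f x t c → f :* (x :- c) := f :* (x :- t) :+ (t :- c) :* f) refl

  fall-suc : ∀ x j → fall x (suc j) ≈ x * fall (x - 1#) j
  fall-suc x zero    = solve 1 (λ x → :1 :* (x :- :0) := x :* :1) refl x
  fall-suc x (suc j) = trans (*-congʳ (fall-suc x j)) (reassoc x (fall (x - 1#) j) (ι j))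
    where
    reassoc : ∀ x f t → (x * f) * (x - (1# + t)) ≈ x * (f * ((x - 1#) - t))
    reassoc = solve 3 (λ x f t → (x :* f) :* (x :- (:1 :+ t)) := x :* (f :* ((x :- :1) :- t))) refl

  fall-ι-vanish : ∀ k j → k < j → fall (ι k) j ≈ 0#
  fall-ι-vanish k (suc j) (s≤s k≤j) with m≤n⇒m<n∨m≡n k≤j
  ... | inj₁ k<j    = trans (*-congʳ (fall-ι-vanish k j k<j)) (zeroˡ _)
  ... | inj₂ ≡.refl = trans (*-congˡ (-‿inverseʳ (ι k))) (zeroʳ _)

  fall-ι-diag : ∀ k → fall (ι k) k ≈ ι (k !)
  fall-ι-diag zero    = sym (+-identityʳ 1#)
  fall-ι-diag (suc k) = begin
    fall (ι (suc k)) (suc k)             ≈⟨ fall-suc (ι (suc k)) k ⟩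
    ι (suc k) * fall (1# + ι k - 1#) k   ≈⟨ *-congˡ (fall-cong k (1+t-1≈t (ι k))) ⟩
    ι (suc k) * fall (ι k) k             ≈⟨ *-congˡ (fall-ι-diag k) ⟩
    ι (suc k) * ι (k !)                  ≈⟨ ι-* (suc k) (k !) ⟨
    ι (suc k !)                          ∎
    where
    1+t-1≈t : ∀ t → 1# + t - 1# ≈ t
    1+t-1≈t = solve 1 (λ t → :1 :+ t :- :1 := t) refl

  module FactorialInverses (inv : ℕ → Carrier) (inv-hyp : ∀ m → inv m * ι (m !) ≈ 1#) where

    inv-zero : inv 0 ≈ 1#
    inv-zero = trans (sym (*-identityʳ _)) (trans (*-congˡ (sym (+-identityʳ 1#))) (inv-hyp 0))

    inv-step : ∀ m → ι (suc m) * inv (suc m) ≈ inv m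
    inv-step m = begin
      ι (suc m) * inv (suc m)                           ≈⟨ *-identityʳ _ ⟨
      (ι (suc m) * inv (suc m)) * 1#                    ≈⟨ *-congˡ (inv-hyp m) ⟨
      (ι (suc m) * inv (suc m)) * (inv m * ι (m !))     ≈⟨ rearrange _ _ _ _ ⟩
      inv m * (inv (suc m) * (ι (suc m) * ι (m !)))     ≈⟨ *-congˡ (*-congˡ (ι-* (suc m) (m !))) ⟨
      inv m * (inv (suc m) * ι (suc m !))               ≈⟨ *-congˡ (inv-hyp (suc m)) ⟩
      inv m * 1#                                        ≈⟨ *-identityʳ _ ⟩
      inv m                                             ∎
      where
      rearrange : ∀ a b c d → (a * b) * (c * d) ≈ c * (b * (a * d))
      rearrange = solve 4 (λ a b c d → (a :* b) :* (c :* d) := c :* (b :* (a :* d))) refl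

    factorial-cancel : ∀ k {a} → a * ι (k !) ≈ 0# → a ≈ 0#
    factorial-cancel k {a} a*k!≈0 = begin
      a                       ≈⟨ *-identityʳ a ⟨
      a * 1#                  ≈⟨ *-congˡ (inv-hyp k) ⟨
      a * (inv k * ι (k !))   ≈⟨ *-congˡ (*-comm _ _) ⟩
      a * (ι (k !) * inv k)   ≈⟨ *-assoc _ _ _ ⟨
      (a * ι (k !)) * inv k   ≈⟨ *-congʳ a*k!≈0 ⟩
      0# * inv k              ≈⟨ zeroˡ _ ⟩
      0#                      ∎

    fall-coeffs-zero : ∀ n (a : ℕ → Carrier) → (∀ x → sumTo n (λ j → a j * fall x j) ≈ 0#) →
                       ∀ k → k ≤ n → a k ≈ 0#
    fall-coeffs-zero n a Σ≈0 = <-rec (λ k → k ≤ n → a k ≈ 0#) step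
      where
      step : ∀ k → (∀ {j} → j < k → j ≤ n → a j ≈ 0#) → k ≤ n → a k ≈ 0#
      step k ih k≤n = factorial-cancel k (begin
        a k * ι (k !)                        ≈⟨ *-congˡ (fall-ι-diag k) ⟨
        a k * fall (ι k) k                   ≈⟨ sumTo-single n k _ k≤n off-diagonal ⟨
        sumTo n (λ j → a j * fall (ι k) j)   ≈⟨ Σ≈0 (ι k) ⟩
        0#                                   ∎)
        where
        off-diagonal : ∀ j → j ≤ n → j ≢ k → a j * fall (ι k) j ≈ 0#
        off-diagonal j j≤n j≢k with ℕ.<-cmp j k
        ... | tri< j<k _ _ = trans (*-congʳ (ih j<k j≤n)) (zeroˡ _)
        ... | tri≈ _ j≡k _ = contradiction j≡k j≢k
        ... | tri> _ _ k<j = trans (*-congˡ (fall-ι-vanish k j k<j)) (zeroʳ _)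

  module DegenerateStirling (lam : Carrier) where

    stirling₂ : ℕ → ℕ → Carrier
    stirling₂ zero    zero    = 1#
    stirling₂ zero    (suc k) = 0#
    stirling₂ (suc n) zero    = (ι 0 - ι n * lam) * stirling₂ n 0
    stirling₂ (suc n) (suc k) = stirling₂ n k + (ι (suc k) - ι n * lam) * stirling₂ n (suc k)

    stirling₂-above : ∀ n k → n < k → stirling₂ n k ≈ 0#
    stirling₂-above zero    (suc k) _         = refl
    stirling₂-above (suc n) (suc k) (s≤s n<k) =
      trans (+-cong (stirling₂-above n k n<k)
                    (trans (*-congˡ (stirling₂-above n (suc k) (ℕ.m<n⇒m<1+n n<k))) (zeroʳ _)))
            (+-identityʳ 0#)

    stirling₂-col0 : ∀ n → stirling₂ (suc n) 0 ≈ 0#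
    stirling₂-col0 zero    = solve 1 (λ λ′ → (:0 :- :0 :* λ′) :* :1 := :0) refl lam
    stirling₂-col0 (suc n) = trans (*-congˡ (stirling₂-col0 n)) (zeroʳ _)

    stirling₂-step : ∀ n (v w : ℕ → Carrier) → (∀ j → v j ≈ w (suc j) + (ι j - ι n * lam) * w j) →
                     sumTo n (λ j → stirling₂ n j * v j) ≈
                     sumTo (suc n) (λ j → stirling₂ (suc n) j * w j)
    stirling₂-step n v w v≈ = begin
      sumTo n (λ j → S j * v j)
        ≈⟨ sumTo-cong n (λ j _ → trans (*-congˡ (v≈ j)) (expand _ _ _ _)) ⟩
      sumTo n (λ j → P j + Q j)
        ≈⟨ sumTo-distrib-+ n P Q ⟩
      sumTo n P + sumTo n Q
        ≈⟨ +-congˡ ΣQ ⟩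
      sumTo n P + (Q 0 + sumTo n (λ j → Q (suc j)))
        ≈⟨ +-leftComm _ _ _ ⟩
      Q 0 + (sumTo n P + sumTo n (λ j → Q (suc j)))
        ≈⟨ +-congˡ (sumTo-distrib-+ n P (λ j → Q (suc j))) ⟨
      Q 0 + sumTo n (λ j → P j + Q (suc j))
        ≈⟨ +-congˡ (sumTo-cong n (λ j _ → distribʳ _ _ _)) ⟨
      Q 0 + sumTo n (λ j → stirling₂ (suc n) (suc j) * w (suc j))
        ≈⟨ sumTo-shift n _ ⟨
      sumTo (suc n) (λ j → stirling₂ (suc n) j * w j)
        ∎
      where
      S c P Q : ℕ → Carrier
      S   = stirling₂ n
      c j = ι j - ι n * lam
      P j = S j * w (suc j)
      Q j = (c j * S j) * w j
      expand : ∀ s x c y → s * (x + c * y) ≈ s * x + (c * s) * y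
      expand = solve 4 (λ s x c y → s :* (x :+ c :* y) := s :* x :+ (c :* s) :* y) refl
      Q-top : Q (suc n) ≈ 0#
      Q-top = trans (*-congʳ (trans (*-congˡ (stirling₂-above n (suc n) ≤-refl)) (zeroʳ _))) (zeroˡ _)
      ΣQ : sumTo n Q ≈ Q 0 + sumTo n (λ j → Q (suc j))
      ΣQ = begin
        sumTo n Q                        ≈⟨ +-identityʳ _ ⟨
        sumTo n Q + 0#                   ≈⟨ +-congˡ Q-top ⟨
        sumTo (suc n) Q                  ≈⟨ sumTo-shift n Q ⟩
        Q 0 + sumTo n (λ j → Q (suc j))  ∎

    stirling₂-isDegStirling2 : IsDegStirling2 lam stirling₂
    stirling₂-isDegStirling2 zero    x = sym (*-identityˡ 1#)
    stirling₂-isDegStirling2 (suc n) x = begin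
      dfall lam x n * (x - c)
        ≈⟨ *-congʳ (stirling₂-isDegStirling2 n x) ⟩
      sumTo n (λ j → stirling₂ n j * fall x j) * (x - c)
        ≈⟨ *-distribʳ-sumTo n _ _ ⟩
      sumTo n (λ j → stirling₂ n j * fall x j * (x - c))
        ≈⟨ sumTo-cong n (λ j _ → *-assoc _ _ _) ⟩
      sumTo n (λ j → stirling₂ n j * (fall x j * (x - c)))
        ≈⟨ stirling₂-step n _ (fall x) (fall-step x c) ⟩
      sumTo (suc n) (λ j → stirling₂ (suc n) j * fall x j)
        ∎
      where
      c : Carrier
      c = ι n * lam

    module _ (inv : ℕ → Carrier) (inv-hyp : ∀ m → inv m * ι (m !) ≈ 1#)
             {S : ℕ → ℕ → Carrier} (S-hyp : IsDegStirling2 lam S) where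
      open FactorialInverses inv inv-hyp

      isDegStirling2-unique : ∀ n k → k ≤ n → S n k ≈ stirling₂ n k
      isDegStirling2-unique n k k≤n =
        x∙y⁻¹≈ε⇒x≈y _ _ (fall-coeffs-zero n (λ j → S n j - stirling₂ n j) Σ≈0 k k≤n)
        where
        Σ≈0 : ∀ x → sumTo n (λ j → (S n j - stirling₂ n j) * fall x j) ≈ 0#
        Σ≈0 x = begin
          sumTo n (λ j → (S n j - stirling₂ n j) * fall x j)
            ≈⟨ sumTo-cong n (λ j _ → [y-z]x≈yx-zx _ _ _) ⟩
          sumTo n (λ j → S n j * fall x j - stirling₂ n j * fall x j)
            ≈⟨ sumTo-distrib-sub n _ _ ⟩
          sumTo n (λ j → S n j * fall x j) - sumTo n (λ j → stirling₂ n j * fall x j)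
            ≈⟨ +-cong (S-hyp n x) (-‿cong (stirling₂-isDegStirling2 n x)) ⟨
          dfall lam x n - dfall lam x n
            ≈⟨ -‿inverseʳ _ ⟩
          0#
            ∎

      degBell≈sum1To : ∀ n → degBell S (suc n) ≈ sum1To (suc n) (S (suc n))
      degBell≈sum1To n = begin
        sumTo (suc n) (S (suc n))                          ≈⟨ sumTo≈head+sum1To (suc n) (S (suc n)) ⟩
        S (suc n) 0 + sum1To (suc n) (S (suc n))           ≈⟨ +-congʳ (isDegStirling2-unique (suc n) 0 z≤n) ⟩
        stirling₂ (suc n) 0 + sum1To (suc n) (S (suc n))   ≈⟨ +-congʳ (stirling₂-col0 n) ⟩
        0# + sum1To (suc n) (S (suc n))                    ≈⟨ +-identityˡ _ ⟩
        sum1To (suc n) (S (suc n))                         ∎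

  module BAlgorithm (lam : Carrier) (inv : ℕ → Carrier) (inv-hyp : ∀ m → inv m * ι (m !) ≈ 1#) where
    open DegenerateStirling lam
    open FactorialInverses inv inv-hyp

    bStep : Carrier → (ℕ → Carrier) → ℕ → Carrier
    bStep c u m = (ι m - c) * u m - ι (suc m) * u (suc m)

    ψ : ℕ → ℕ → Carrier
    ψ zero    m       = sgn m * inv m
    ψ (suc j) zero    = ψ j zero
    ψ (suc j) (suc m) = ψ j (suc m) - ψ j m

    ψ-col0 : ∀ j → ψ j 0 ≈ 1#
    ψ-col0 zero    = trans (*-identityˡ _) inv-zero
    ψ-col0 (suc j) = ψ-col0 j

    ψ₀-step : ∀ m → ι (suc m) * ψ 0 (suc m) ≈ - ψ 0 m
    ψ₀-step m = begin
      ι (suc m) * (- sgn m * inv (suc m))     ≈⟨ pull-sign _ _ _ ⟩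
      - (sgn m * (ι (suc m) * inv (suc m)))   ≈⟨ -‿cong (*-congˡ (inv-step m)) ⟩
      - (sgn m * inv m)                       ∎
      where
      pull-sign : ∀ a s b → a * (- s * b) ≈ - (s * (a * b))
      pull-sign = solve 3 (λ a s b → a :* (:- s :* b) := :- (s :* (a :* b))) refl

    -- Coefficientwise: (t - 1) d/dt ((1 - t)^j e^(-t)) = (1 - t)^(j+1) e^(-t) + j (1 - t)^j e^(-t).
    ψ-euler : ∀ j m → ι m * ψ j m - ι (suc m) * ψ j (suc m) ≈ ψ (suc j) m + ι j * ψ j m
    ψ-euler zero zero =
      trans (+-congˡ (-‿cong (ψ₀-step 0)))
            (solve 1 (λ x → :0 :* x :- (:- x) := x :+ :0 :* x) refl (ψ 0 0))
    ψ-euler zero (suc m) =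
      trans (+-cong (ψ₀-step m) (-‿cong (ψ₀-step (suc m))))
            (solve 2 (λ a b → :- a :- (:- b) := (b :- a) :+ :0 :* b) refl (ψ 0 m) (ψ 0 (suc m)))
    ψ-euler (suc j) zero = begin
      0# * a - (1# + 0#) * (b - a)   ≈⟨ regroup a b ⟩
      (0# * a - (1# + 0#) * b) + a   ≈⟨ +-congʳ (ψ-euler j 0) ⟩
      (a + ι j * a) + a              ≈⟨ collect a (ι j) ⟩
      a + (1# + ι j) * a             ∎
      where
      a b : Carrier
      a = ψ j 0
      b = ψ j 1
      regroup : ∀ a b → 0# * a - (1# + 0#) * (b - a) ≈ (0# * a - (1# + 0#) * b) + a
      regroup = solve 2 (λ a b → :0 :* a :- (:1 :+ :0) :* (b :- a) := (:0 :* a :- (:1 :+ :0) :* b) :+ a) refl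
      collect : ∀ a t → (a + t * a) + a ≈ a + (1# + t) * a
      collect = solve 2 (λ a t → (a :+ t :* a) :+ a := a :+ (:1 :+ t) :* a) refl
    ψ-euler (suc j) (suc m) = begin
      (1# + v) * (b - a) - (1# + (1# + v)) * (c - b)
        ≈⟨ regroup a b c v ⟩
      ((1# + v) * b - (1# + (1# + v)) * c) - (v * a - (1# + v) * b) + (b - a)
        ≈⟨ +-congʳ (+-cong (ψ-euler j (suc m)) (-‿cong (ψ-euler j m))) ⟩
      ((b - a) + ι j * b) - (ψ (suc j) m + ι j * a) + (b - a)
        ≈⟨ collect a b (ψ (suc j) m) (ι j) ⟩
      ((b - a) - ψ (suc j) m) + (1# + ι j) * (b - a)
        ∎
      where
      a b c v : Carrier
      a = ψ j m
      b = ψ j (suc m)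
      c = ψ j (suc (suc m))
      v = ι m
      regroup : ∀ a b c v → (1# + v) * (b - a) - (1# + (1# + v)) * (c - b) ≈
                            ((1# + v) * b - (1# + (1# + v)) * c) - (v * a - (1# + v) * b) + (b - a)
      regroup = solve 4 (λ a b c v →
        (:1 :+ v) :* (b :- a) :- (:1 :+ (:1 :+ v)) :* (c :- b)
          := ((:1 :+ v) :* b :- (:1 :+ (:1 :+ v)) :* c) :- (v :* a :- (:1 :+ v) :* b) :+ (b :- a)) refl
      collect : ∀ a b w t → ((b - a) + t * b) - (w + t * a) + (b - a) ≈ ((b - a) - w) + (1# + t) * (b - a)
      collect = solve 4 (λ a b w t →
        ((b :- a) :+ t :* b) :- (w :+ t :* a) :+ (b :- a) := ((b :- a) :- w) :+ (:1 :+ t) :* (b :- a)) refl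

    ψ-bStep : ∀ c j m → bStep c (ψ j) m ≈ ψ (suc j) m + (ι j - c) * ψ j m
    ψ-bStep c j m = begin
      (ι m - c) * ψ j m - ι (suc m) * ψ j (suc m)           ≈⟨ split (ι m) c _ _ _ ⟩
      (ι m * ψ j m - ι (suc m) * ψ j (suc m)) - c * ψ j m   ≈⟨ +-congʳ (ψ-euler j m) ⟩
      (ψ (suc j) m + ι j * ψ j m) - c * ψ j m               ≈⟨ collect _ (ι j) c _ ⟩
      ψ (suc j) m + (ι j - c) * ψ j m                       ∎
      where
      split : ∀ p c q x y → (p - c) * x - q * y ≈ (p * x - q * y) - c * x
      split = solve 5 (λ p c q x y → (p :- c) :* x :- q :* y := (p :* x :- q :* y) :- c :* x) refl
      collect : ∀ z t c x → (z + t * x) - c * x ≈ z + (t - c) * x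
      collect = solve 4 (λ z t c x → (z :+ t :* x) :- c :* x := z :+ (t :- c) :* x) refl

    bStep-cong : ∀ c {u v : ℕ → Carrier} → (∀ m → u m ≈ v m) → ∀ m → bStep c u m ≈ bStep c v m
    bStep-cong c u≈v m = +-cong (*-congˡ (u≈v m)) (-‿cong (*-congˡ (u≈v (suc m))))

    bStep-sumTo : ∀ c n (t : ℕ → Carrier) (u : ℕ → ℕ → Carrier) m →
                  bStep c (λ m → sumTo n (λ j → t j * u j m)) m ≈ sumTo n (λ j → t j * bStep c (u j) m)
    bStep-sumTo c n t u m = begin
      a * sumTo n (λ j → t j * u j m) - b * sumTo n (λ j → t j * u j (suc m))
        ≈⟨ +-cong (*-distribˡ-sumTo n a _) (-‿cong (*-distribˡ-sumTo n b _)) ⟩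
      sumTo n (λ j → a * (t j * u j m)) - sumTo n (λ j → b * (t j * u j (suc m)))
        ≈⟨ sumTo-distrib-sub n _ _ ⟨
      sumTo n (λ j → a * (t j * u j m) - b * (t j * u j (suc m)))
        ≈⟨ sumTo-cong n (λ j _ → factor a b (t j) _ _) ⟩
      sumTo n (λ j → t j * bStep c (u j) m)
        ∎
      where
      a b : Carrier
      a = ι m - c
      b = ι (suc m)
      factor : ∀ a b t x y → a * (t * x) - b * (t * y) ≈ t * (a * x - b * y)
      factor = solve 5 (λ a b t x y → a :* (t :* x) :- b :* (t :* y) := t :* (a :* x :- b :* y)) refl

    bStep-expansion : ∀ n (u : ℕ → Carrier) →
                      (∀ m → u m ≈ sumTo n (λ j → stirling₂ n j * ψ j m)) → ∀ m → bStep (ι n * lam) u m ≈ sumTo (suc n) (λ j → stirling₂ (suc n) j * ψ j m)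
    bStep-expansion n u u≈ m = begin
      bStep c u m
        ≈⟨ bStep-cong c u≈ m ⟩
      bStep c (λ m → sumTo n (λ j → stirling₂ n j * ψ j m)) m
        ≈⟨ bStep-sumTo c n (stirling₂ n) ψ m ⟩
      sumTo n (λ j → stirling₂ n j * bStep c (ψ j) m)
        ≈⟨ stirling₂-step n _ (λ j → ψ j m) (λ j → ψ-bStep c j m) ⟩
      sumTo (suc n) (λ j → stirling₂ (suc n) j * ψ j m)
        ∎
      where
      c : Carrier
      c = ι n * lam

    -- a₀,₀ = 0 differs from ψ 0 0 = 1, but enters a₁,₀ only through the factor 0 - 0 λ.
    amat₁≈bStep-ψ₀ : ∀ m → amat lam inv 1 m ≈ bStep (ι 0 * lam) (ψ 0) m
    amat₁≈bStep-ψ₀ zero    = +-congʳ (trans (vanish 0#) (sym (vanish (ψ 0 0))))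
      where
      vanish : ∀ y → (0# - 0# * lam) * y ≈ 0#
      vanish = solve 2 (λ λ′ y → (:0 :- :0 :* λ′) :* y := :0) refl lam
    amat₁≈bStep-ψ₀ (suc m) = refl

    amat-expansion : ∀ n m → amat lam inv (suc n) m ≈ sumTo (suc n) (λ j → stirling₂ (suc n) j * ψ j m)
    amat-expansion zero    m =
      trans (amat₁≈bStep-ψ₀ m) (bStep-expansion 0 (ψ 0) (λ m → sym (*-identityˡ _)) m)
    amat-expansion (suc n) m = bStep-expansion (suc n) (amat lam inv (suc n)) (amat-expansion n) m

    amat-col0 : ∀ {S} → IsDegStirling2 lam S → ∀ n → amat lam inv (suc n) 0 ≈ degBell S (suc n)
    amat-col0 {S} S-hyp n = begin
      amat lam inv (suc n) 0                              ≈⟨ amat-expansion n 0 ⟩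
      sumTo (suc n) (λ j → stirling₂ (suc n) j * ψ j 0)   ≈⟨ sumTo-cong (suc n) coefficient ⟩
      sumTo (suc n) (S (suc n))                           ∎
      where
      coefficient : ∀ j → j ≤ suc n → stirling₂ (suc n) j * ψ j 0 ≈ S (suc n) j
      coefficient j j≤1+n = begin
        stirling₂ (suc n) j * ψ j 0   ≈⟨ *-congˡ (ψ-col0 j) ⟩
        stirling₂ (suc n) j * 1#      ≈⟨ *-identityʳ _ ⟩
        stirling₂ (suc n) j           ≈⟨ isDegStirling2-unique inv inv-hyp S-hyp (suc n) j j≤1+n ⟨
        S (suc n) j                   ∎

theorem2p7 : ∀ {c ℓ} (R : CommutativeRing c ℓ) →
    let open CommutativeRing R
        open Ops R
    in (lam : Carrier) → ¬ (lam ≈ 0#) →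
       (inv : ℕ → Carrier) → (∀ m → inv m * ι (m !) ≈ 1#) →
       (S : ℕ → ℕ → Carrier) → IsDegStirling2 lam S →
       ∀ n → 1 ≤ n →
       (amat lam inv n 0 ≈ sum1To n (S n)) × (sum1To n (S n) ≈ degBell S n)
theorem2p7 R lam _ inv inv-hyp S S-hyp (suc n) _ =
  trans (amat-col0 S-hyp n) bell≈sum1 , sym bell≈sum1
  where
  open CommutativeRing R using (_≈_; sym; trans)
  open Ops R using (degBell; sum1To)
  open BAlgorithm R lam inv inv-hyp using (amat-col0)
  bell≈sum1 : degBell S (suc n) ≈ sum1To (suc n) (S (suc n))
  bell≈sum1 = DegenerateStirling.degBell≈sum1To R lam inv inv-hyp S-hyp n
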